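{- Let $\mu$ be a partition of $k$ with parts $\mu_1\ge\dots\ge\mu_l>0$ ($l=\ell(\mu)$), let $$\sigma_\mu=(1,2,\dots,\mu_1+1)(\mu_1+2,\dots,\mu_1+\mu_2+2)\cdots(\mu_1+\dots+\mu_{l-1}+l,\dots,k+l),$$ and let $t_1,\dots,t_k$ be integers with $2\le t_1\le\dots\le t_k$. Then the coefficient $[\sigma_\mu]J_{t_1}\cdots J_{t_k}$ equals $1$ if $$(t_{\mu_1+\dots+\mu_{i-1}+1},\dots,t_{\mu_1+\dots+\mu_{i-1}+\mu_i})\in\mathfrak E(\mu_1+\dots+\mu_{i-1}+i;\ \mu_i)\quad\text{for all }1\le i\le l,$$ and equals $0$ otherwise.
   Context: Work in the group algebra of the group of permutations of the positive integers fixing all but finitely many points (equivalently in $\mathbb C[S(n)]$ for any $n\ge\max(t_k,k+l)$), with products of permutations given by composition, rightmost factor first. $J_t=\sum_{s=1}^{t-1}(s,t)$ is the Jucys–Murphy element, and for an element $x$ of the group algebra, $[\sigma]x$ denotes the coefficient of the permutation $\sigma$ in $x$. For integers $a\ge1$, $r\ge1$, $\mathfrak E(a;r)$ is the set of integer sequences $(i_1,\dots,i_r)$ with $i_1\le\dots\le i_r$, $i_p\ge a+p$ for $1\le p\le r-1$, and $i_r=a+r$. -}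

module Defs where

open import Data.Nat using (ℕ; zero; suc; _+_; _≤_; _<_; _≟_; _<?_)
open import Data.Nat.Properties using ()
open import Data.Integer using (ℤ; _*_) renaming (_+_ to _+ℤ_; +_ to ℤ+)
open import Data.Fin using (Fin; toℕ) renaming (_≟_ to _≟F_)
open import Data.Fin.Properties using (all?)
open import Data.List using (List; []; _∷_; concatMap; foldr; map; take; drop; length; lookup; allFin)
open import Data.List.Relation.Unary.Linked using (Linked)
import Data.List.Relation.Unary.All
import Data.List
import Data.Nat.ListAction
import Data.Nat
open import Data.Bool using (Bool; true; false; if_then_else_; _∧_)
open import Data.Product using (_×_; _,_)
open import Data.Unit using (⊤)
open import Relation.Nullary using (Dec; yes; no)
open import Relation.Nullary.Decidable using (⌊_⌋)
open import Relation.Binary.PropositionalEquality using (_≡_)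
open import Function using (_∘_; id)

-- The points 1,…,n are represented by Fin n,
-- the point i : Fin n having label  toℕ i + 1.
-- A permutation is a function Fin n → Fin n; all elements built below are
-- genuine permutations.  Product = composition, rightmost factor first.

label : {n : ℕ} → Fin n → ℕ
label i = suc (toℕ i)

Perm : ℕ → Set
Perm n = Fin n → Fin n

_∙_ : {n : ℕ} → Perm n → Perm n → Perm n
σ ∙ τ = σ ∘ τ

transp : {n : ℕ} → Fin n → Fin n → Perm n
transp a b i = if ⌊ i ≟F a ⌋ then b else (if ⌊ i ≟F b ⌋ then a else i)

GA : ℕ → Set
GA n = List (ℤ × Perm n)

one : {n : ℕ} → GA n
one = (ℤ+ 1 , id) ∷ []

_⊛_ : {n : ℕ} → GA n → GA n → GA n
x ⊛ y = concatMap (λ { (a , p) → map (λ { (b , q) → (a * b , p ∙ q) }) y }) x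

prodGA : {n : ℕ} → List (GA n) → GA n
prodGA = foldr _⊛_ one

-- A permutation of S(n) given by its action on labels σ : ℕ → ℕ.
-- p represents σ iff label (p i) = σ (label i) for all points i.
Represents : {n : ℕ} → Perm n → (ℕ → ℕ) → Set
Represents {n} p σ = (i : Fin n) → label (p i) ≡ σ (label i)

represents? : {n : ℕ} (p : Perm n) (σ : ℕ → ℕ) → Dec (Represents p σ)
represents? p σ = all? (λ i → label (p i) ≟ σ (label i))

coeff : {n : ℕ} → (ℕ → ℕ) → GA n → ℤ
coeff σ [] = ℤ+ 0
coeff σ ((c , p) ∷ x) = (if ⌊ represents? p σ ⌋ then c else ℤ+ 0) +ℤ coeff σ x

-- Jucys–Murphy element J_t = Σ_{s=1}^{t-1} (s , t) in Z[S(n)]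
J : (n t : ℕ) → GA n
J n t = concatMap (λ u → concatMap (λ s →
          if ⌊ label u ≟ t ⌋ ∧ ⌊ label s <? t ⌋ then (ℤ+ 1 , transp s u) ∷ [] else [])
          (allFin n)) (allFin n)

JProd : (n : ℕ) → List ℕ → GA n
JProd n ts = prodGA (map (J n) ts)

-- σ_μ as a map on labels: the product of the cycles
-- (c , c+1 , … , c+m) for consecutive blocks, starting at c = 1.

sigmaFrom : ℕ → List ℕ → ℕ → ℕ
sigmaFrom c [] x = x
sigmaFrom c (m ∷ ms) x =
  if ⌊ c Data.Nat.≤? x ⌋ ∧ ⌊ x <? c + m ⌋ then suc x
  else (if ⌊ x ≟ c + m ⌋ then c else sigmaFrom (c + m + 1) ms x)

sigma : List ℕ → ℕ → ℕ
sigma μ = sigmaFrom 1 μ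

InE : ℕ → ℕ → List ℕ → Set
InE a r xs =
  (length xs ≡ r)
  × Linked _≤_ xs
  × ((p : Fin (length xs)) → suc (toℕ p) < r → a + suc (toℕ p) ≤ lookup xs p)
  × ((p : Fin (length xs)) → suc (toℕ p) ≡ r → lookup xs p ≡ a + r)

-- The condition of the proposition: for each block i (starting at a = μ_1+…+μ_{i-1}+i),
-- the segment (t_{P+1},…,t_{P+μ_i}) with P = μ_1+…+μ_{i-1} lies in 𝔈(a; μ_i).
BlockCond : ℕ → List ℕ → List ℕ → Set
BlockCond a [] ts = ⊤
BlockCond a (m ∷ ms) ts = InE a m (take m ts) × BlockCond (a + m + 1) ms (drop m ts)

IsPartition : ℕ → List ℕ → Set
IsPartition k μ = Linked (λ a b → b ≤ a) μ
                  × Data.List.Relation.Unary.All.All (λ m → 0 < m) μ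
                  × Data.Nat.ListAction.sum μ ≡ k

-- Expanding J_t = Σ_{s<t} (s t), the coefficient of σ is the number `paths n ts σ` of tuples
-- (s₁,…,s_k) with s_i < t_i and (s₁ t₁)⋯(s_k t_k) = σ (coeff-JProd).  It is evaluated by peeling off
-- the last factor: paths (ts ++ [T]) σ = Σ_{s<T} paths ts (σ ∘ (s T)).  Most terms vanish, either
-- because σ moves a point above every t_i (paths-moved) or because σ has more excedances than there
-- are factors: each transposition destroys at most one, and σ_μ has |μ| (paths-excedances,
-- excedances-sigma).  If T ends the last block (d, …, P) of μ, the surviving terms are s = d + i, and
-- σ_μ ∘ (d+i P) is σ for μ with its last block cut into lengths i and m - i; by induction each term is
-- the indicator of the cut condition, and splitting sequences in 𝔈 (split-above, split-unique,
-- split-exists) shows that exactly one cut satisfies it iff the condition for μ holds.  The induction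
-- runs over all compositions μ (cuts create zero parts).
module Submission where

open import Defs
open import Data.Nat using (ℕ; _+_; _≤_)
open import Data.Integer using (ℤ; +_)
open import Data.List using (List; length)
open import Data.List.Relation.Unary.All using (All)
open import Data.List.Relation.Unary.Linked using (Linked)
open import Data.Product using (_×_)
open import Relation.Nullary using (¬_)
open import Relation.Binary.PropositionalEquality using (_≡_)

open import Data.Nat using (zero; suc; _∸_; _<_; z≤n; s≤s; _≟_; _<?_; _≤?_; pred)
import Data.Nat.Properties as ℕₚ
open import Data.Nat.ListAction using (sum)
import Data.Nat.ListAction.Properties as Sumₚ
open import Data.Nat.Tactic.RingSolver using (solve-∀)
open import Algebra.Properties.CommutativeSemigroup ℕₚ.+-commutativeSemigroup using (interchange)
import Data.Integer as ℤ
import Data.Integer.Properties as ℤₚ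
open import Data.Fin as Fin using (Fin; toℕ)
import Data.Fin.Properties as Finₚ
open import Data.List using ([]; _∷_; _++_; _∷ʳ_; concatMap; tabulate; take; drop; lookup)
import Data.List.Properties as Listₚ
open import Data.List.Reverse using (Reverse; reverseView; []; _∶_∶ʳ_)
open import Data.List.Relation.Unary.All using ([]; _∷_) renaming (map to mapAll)
import Data.List.Relation.Unary.All.Properties as Allₚ
open import Data.List.Relation.Unary.Linked using ([]; [-]; _∷_)
import Data.List.Relation.Unary.Linked.Properties as Linkedₚ
import Data.List.Relation.Unary.AllPairs.Properties as AllPairsₚ
open import Data.Bool using (true; false; if_then_else_; _∧_)
open import Data.Empty using (⊥; ⊥-elim)
open import Data.Unit using (tt)
open import Data.Sum using (_⊎_; inj₁; inj₂)
open import Data.Product using (_,_; proj₁; proj₂; ∃; Σ-syntax)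
open import Function using (_∘_; id)
open import Function.Bundles using (_⇔_; mk⇔; Equivalence)
open import Relation.Nullary using (Dec; yes; no)
open import Relation.Nullary.Decidable using (⌊_⌋)
open import Relation.Binary.Definitions using (tri<; tri≈; tri>)
open import Relation.Binary.PropositionalEquality
  using (refl; sym; trans; cong; cong₂; subst; subst₂; _≢_; module ≡-Reasoning)

dec-iff : ∀ {a b} {A : Set a} {B : Set b} (p : Dec A) (q : Dec B) →
          (A → B) → (B → A) → ⌊ p ⌋ ≡ ⌊ q ⌋
dec-iff (yes _) (yes _) _ _ = refl
dec-iff (yes a) (no ¬b) f _ = ⊥-elim (¬b (f a))
dec-iff (no ¬a) (yes b) _ g = ⊥-elim (¬a (g b))
dec-iff (no _)  (no _)  _ _ = refl

⌊⌋-true : ∀ {p} {P : Set p} (d : Dec P) → P → ⌊ d ⌋ ≡ true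
⌊⌋-true (yes _) _ = refl
⌊⌋-true (no ¬p) p = ⊥-elim (¬p p)

⌊⌋-false : ∀ {p} {P : Set p} (d : Dec P) → ¬ P → ⌊ d ⌋ ≡ false
⌊⌋-false (yes p) ¬p = ⊥-elim (¬p p)
⌊⌋-false (no _)  _  = refl

if-holds : ∀ {p} {P : Set p} {A : Set} (d : Dec P) {x y : A} → P → (if ⌊ d ⌋ then x else y) ≡ x
if-holds d p rewrite ⌊⌋-true d p = refl

if-fails : ∀ {p} {P : Set p} {A : Set} (d : Dec P) {x y : A} → ¬ P → (if ⌊ d ⌋ then x else y) ≡ y
if-fails d ¬p rewrite ⌊⌋-false d ¬p = refl

Σ : ℕ → (ℕ → ℕ) → ℕ
Σ zero    f = 0
Σ (suc n) f = f 0 + Σ n (f ∘ suc)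

Σ-cong : ∀ n {f g : ℕ → ℕ} → (∀ j → j < n → f j ≡ g j) → Σ n f ≡ Σ n g
Σ-cong zero    h = refl
Σ-cong (suc n) h = cong₂ _+_ (h 0 (s≤s z≤n)) (Σ-cong n (λ j j<n → h (suc j) (s≤s j<n)))

Σ-zero : ∀ n {f : ℕ → ℕ} → (∀ j → j < n → f j ≡ 0) → Σ n f ≡ 0
Σ-zero zero    h = refl
Σ-zero (suc n) h rewrite h 0 (s≤s z≤n) = Σ-zero n (λ j j<n → h (suc j) (s≤s j<n))

Σ-mono : ∀ n {f g : ℕ → ℕ} → (∀ j → j < n → f j ≤ g j) → Σ n f ≤ Σ n g
Σ-mono zero    h = z≤n
Σ-mono (suc n) h = ℕₚ.+-mono-≤ (h 0 (s≤s z≤n)) (Σ-mono n (λ j j<n → h (suc j) (s≤s j<n)))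

Σ-+ : ∀ n (f g : ℕ → ℕ) → Σ n (λ j → f j + g j) ≡ Σ n f + Σ n g
Σ-+ zero    f g = refl
Σ-+ (suc n) f g = trans (cong (_+_ (f 0 + g 0)) (Σ-+ n (f ∘ suc) (g ∘ suc)))
                        (interchange (f 0) (g 0) (Σ n (f ∘ suc)) (Σ n (g ∘ suc)))

Σ-swap : ∀ a b (f : ℕ → ℕ → ℕ) → Σ a (λ i → Σ b (f i)) ≡ Σ b (λ j → Σ a (λ i → f i j))
Σ-swap zero    b f = sym (Σ-zero b (λ _ _ → refl))
Σ-swap (suc a) b f = trans (cong (_+_ (Σ b (f 0))) (Σ-swap a b (f ∘ suc)))
                           (sym (Σ-+ b (f 0) (λ j → Σ a (λ i → f (suc i) j))))

Σ-split : ∀ a b f → Σ (a + b) f ≡ Σ a f + Σ b (λ j → f (a + j))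
Σ-split zero    b f = refl
Σ-split (suc a) b f = trans (cong (_+_ (f 0)) (Σ-split a b (f ∘ suc))) (sym (ℕₚ.+-assoc (f 0) _ _))

Σ-prefix : ∀ a b f → a ≤ b → Σ a f ≤ Σ b f
Σ-prefix a b f a≤b = begin
  Σ a f                                ≤⟨ ℕₚ.m≤m+n (Σ a f) _ ⟩
  Σ a f + Σ (b ∸ a) (λ j → f (a + j))  ≡⟨ sym (Σ-split a (b ∸ a) f) ⟩
  Σ (a + (b ∸ a)) f                    ≡⟨ cong (λ c → Σ c f) (ℕₚ.m+[n∸m]≡n a≤b) ⟩
  Σ b f                                ∎
  where open ℕₚ.≤-Reasoning

Σ-const1 : ∀ m → Σ m (λ _ → 1) ≡ m
Σ-const1 zero    = refl
Σ-const1 (suc m) = cong suc (Σ-const1 m)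

Σ-single : ∀ n t {f : ℕ → ℕ} → t < n → (∀ j → j < n → j ≢ t → f j ≡ 0) → Σ n f ≡ f t
Σ-single (suc n) zero    _ h =
  trans (cong (_+_ _) (Σ-zero n (λ j j<n → h (suc j) (s≤s j<n) (λ ())))) (ℕₚ.+-identityʳ _)
Σ-single (suc n) (suc t) (s≤s t<n) h rewrite h 0 (s≤s z≤n) (λ ()) =
  Σ-single n t t<n (λ j j<n j≢t → h (suc j) (s≤s j<n) (j≢t ∘ ℕₚ.suc-injective))

Σ-exactly-one : ∀ N (f : ℕ → ℕ) (Q : ℕ → Set) → (∀ i → i < N → (Q i → f i ≡ 1) × (¬ Q i → f i ≡ 0)) →
                (∀ i j → i < N → j < N → Q i → Q j → i ≡ j) → ∀ i₀ → i₀ < N → Q i₀ → Σ N f ≡ 1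
Σ-exactly-one N f Q indicator unique i₀ i₀<N qᵢ₀ =
  trans (Σ-single N i₀ i₀<N (λ j j<N j≢i₀ →
           proj₂ (indicator j j<N) (λ qⱼ → j≢i₀ (unique j i₀ j<N i₀<N qⱼ qᵢ₀))))
        (proj₁ (indicator i₀ i₀<N) qᵢ₀)

Σ-mono-but-one : ∀ n t {f g : ℕ → ℕ} → (∀ j → j < n → j ≢ t → f j ≤ g j) → (∀ j → f j ≤ suc (g j)) →
                 Σ n f ≤ suc (Σ n g)
Σ-mono-but-one zero    t h h₁ = z≤n
Σ-mono-but-one (suc n) zero    h h₁ =
  ℕₚ.+-mono-≤ (h₁ 0) (Σ-mono n (λ j j<n → h (suc j) (s≤s j<n) (λ ())))
Σ-mono-but-one (suc n) (suc t) {g = g} h h₁ = begin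
  _                         ≤⟨ ℕₚ.+-mono-≤ (h 0 (s≤s z≤n) (λ ()))
                                 (Σ-mono-but-one n t (λ j j<n j≢t → h (suc j) (s≤s j<n) (j≢t ∘ ℕₚ.suc-injective))
                                                     (h₁ ∘ suc)) ⟩
  g 0 + suc (Σ n (g ∘ suc)) ≡⟨ ℕₚ.+-suc (g 0) _ ⟩
  suc (Σ (suc n) g)         ∎
  where open ℕₚ.≤-Reasoning

Σ-restrict : ∀ n m (G : ℕ → ℕ) → m ≤ n → Σ n (λ b → if ⌊ suc b <? suc m ⌋ then G b else 0) ≡ Σ m G
Σ-restrict n zero G _ = Σ-zero n (λ j _ → if-fails (suc j <? 1) {x = G j} (λ { (s≤s ()) }))
Σ-restrict (suc n) (suc m) G (s≤s m≤n) = cong (_+_ (G 0)) (trans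
  (Σ-cong n (λ j _ → cong (λ c → if c then G (suc j) else 0)
                       (dec-iff (suc (suc j) <? suc (suc m)) (suc j <? suc m) ℕₚ.≤-pred s≤s)))
  (Σ-restrict n m (G ∘ suc) m≤n))

-- The summation index j of a transposition (j+1  t) ranges over j < t - 1.
below-pred : ∀ j t → j < pred t → suc j < t
below-pred j (suc t) j<t = s≤s j<t

tr : ℕ → ℕ → ℕ → ℕ
tr a b x = if ⌊ x ≟ a ⌋ then b else (if ⌊ x ≟ b ⌋ then a else x)

data TrCase (a b x : ℕ) : Set where
  at-a  : x ≡ a → TrCase a b x
  at-b  : x ≡ b → x ≢ a → TrCase a b x
  other : x ≢ a → x ≢ b → TrCase a b x

trCase : ∀ a b x → TrCase a b x
trCase a b x with x ≟ a | x ≟ b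
... | yes x≡a | _       = at-a x≡a
... | no x≢a  | yes x≡b = at-b x≡b x≢a
... | no x≢a  | no x≢b  = other x≢a x≢b

tr-a : ∀ a b → tr a b a ≡ b
tr-a a b = if-holds (a ≟ a) refl

tr-b : ∀ a b → tr a b b ≡ a
tr-b a b with b ≟ a
... | yes refl = refl
... | no _     = if-holds (b ≟ b) refl

tr-other : ∀ a b x → x ≢ a → x ≢ b → tr a b x ≡ x
tr-other a b x x≢a x≢b = trans (if-fails (x ≟ a) x≢a) (if-fails (x ≟ b) x≢b)

tr-invol : ∀ a b x → tr a b (tr a b x) ≡ x
tr-invol a b x with trCase a b x
... | at-a refl       = trans (cong (tr a b) (tr-a a b)) (tr-b a b)
... | at-b refl _     = trans (cong (tr a b) (tr-b a b)) (tr-a a b)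
... | other x≢a x≢b   = trans (cong (tr a b) (tr-other a b x x≢a x≢b)) (tr-other a b x x≢a x≢b)

tr-preserves : ∀ (S : ℕ → Set) a b x → S a → S b → S x → S (tr a b x)
tr-preserves S a b x Sa Sb Sx with trCase a b x
... | at-a refl     = subst S (sym (tr-a a b)) Sb
... | at-b refl _   = subst S (sym (tr-b a b)) Sa
... | other x≢a x≢b = subst S (sym (tr-other a b x x≢a x≢b)) Sx

-- paths n ts σ counts the tuples (s₁,…,s_k) with s_i < t_i and (s₁ t₁)⋯(s_k t_k) = σ in S(n),
-- choosing the leftmost transposition first: (s t) · rest = σ  iff  rest = (s t) ∘ σ.
paths : ℕ → List ℕ → (ℕ → ℕ) → ℕ
paths n []       σ = if ⌊ represents? {n} id σ ⌋ then 1 else 0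
paths n (t ∷ ts) σ = Σ (pred t) (λ j → paths n ts (tr (suc j) t ∘ σ))

label-≟ : ∀ {n} (i j : Fin n) → ⌊ i Fin.≟ j ⌋ ≡ ⌊ label i ≟ label j ⌋
label-≟ i j = dec-iff (i Fin.≟ j) (label i ≟ label j) (cong label) (Finₚ.toℕ-injective ∘ ℕₚ.suc-injective)

label-transp : ∀ {n} (s u i : Fin n) → label (transp s u i) ≡ tr (label s) (label u) (label i)
label-transp s u i rewrite sym (label-≟ i s) | sym (label-≟ i u) with ⌊ i Fin.≟ s ⌋ | ⌊ i Fin.≟ u ⌋
... | true  | _     = refl
... | false | true  = refl
... | false | false = refl

coeff-transp⊛ : ∀ {n} (s u : Fin n) σ (Y : GA n) →
                coeff σ (((+ 1 , transp s u) ∷ []) ⊛ Y) ≡ coeff (tr (label s) (label u) ∘ σ) Y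
coeff-transp⊛ s u σ [] = refl
coeff-transp⊛ s u σ ((b , q) ∷ Y) = cong₂ ℤ._+_ head (coeff-transp⊛ s u σ Y)
  where
  τ : ℕ → ℕ
  τ = tr (label s) (label u)
  moved : ⌊ represents? (transp s u ∘ q) σ ⌋ ≡ ⌊ represents? q (τ ∘ σ) ⌋
  moved = dec-iff (represents? (transp s u ∘ q) σ) (represents? q (τ ∘ σ))
    (λ r i → trans (sym (tr-invol (label s) (label u) (label (q i)))) (cong τ (trans (sym (label-transp s u (q i))) (r i))))
    (λ r i → trans (label-transp s u (q i)) (trans (cong τ (r i)) (tr-invol (label s) (label u) _)))
  head : (if ⌊ represents? (transp s u ∘ q) σ ⌋ then + 1 ℤ.* b else + 0)
       ≡ (if ⌊ represents? q (τ ∘ σ) ⌋ then b else + 0)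
  head rewrite moved | ℤₚ.*-identityˡ b = refl

coeff-++ : ∀ {n} σ (x y : GA n) → coeff σ (x ++ y) ≡ coeff σ x ℤ.+ coeff σ y
coeff-++ σ [] y = sym (ℤₚ.+-identityˡ _)
coeff-++ σ ((c , p) ∷ x) y = trans (cong (ℤ._+_ head) (coeff-++ σ x y)) (sym (ℤₚ.+-assoc head _ _))
  where head : ℤ
        head = if ⌊ represents? p σ ⌋ then c else + 0

module Additive {B : Set} (Φ : List B → ℤ) (Φ-++ : ∀ x y → Φ (x ++ y) ≡ Φ x ℤ.+ Φ y) where

  Φ-tabulate : ∀ n {A : Set} (f : Fin n → A) (k : A → List B) (g : ℕ → ℕ) →
               (∀ i → Φ (k (f i)) ≡ + g (toℕ i)) → Φ [] ≡ + 0 → Φ (concatMap k (tabulate f)) ≡ + Σ n g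
  Φ-tabulate zero    f k g h Φ-[] = Φ-[]
  Φ-tabulate (suc n) f k g h Φ-[] = trans (Φ-++ (k (f Fin.zero)) _)
    (cong₂ ℤ._+_ (h Fin.zero) (Φ-tabulate n (f ∘ Fin.suc) k (g ∘ suc) (h ∘ Fin.suc) Φ-[]))

Σ-J-indices : ∀ n t (F : ℕ → ℕ → ℕ) → t ≤ n →
  Σ n (λ a → Σ n (λ b → if ⌊ suc a ≟ t ⌋ ∧ ⌊ suc b <? t ⌋ then F a b else 0)) ≡ Σ (pred t) (F (pred t))
Σ-J-indices n zero F _ = Σ-zero n (λ a _ → Σ-zero n (λ b _ → refl))
Σ-J-indices n (suc t) F t<n = trans (Σ-single n t t<n off-row) on-row
  where
  off-row : ∀ a → a < n → a ≢ t →
            Σ n (λ b → if ⌊ suc a ≟ suc t ⌋ ∧ ⌊ suc b <? suc t ⌋ then F a b else 0) ≡ 0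
  off-row a _ a≢t rewrite ⌊⌋-false (suc a ≟ suc t) (a≢t ∘ ℕₚ.suc-injective) = Σ-zero n (λ _ _ → refl)
  on-row : Σ n (λ b → if ⌊ suc t ≟ suc t ⌋ ∧ ⌊ suc b <? suc t ⌋ then F t b else 0) ≡ Σ t (F t)
  on-row rewrite ⌊⌋-true (suc t ≟ suc t) refl = Σ-restrict n t (F t) (ℕₚ.<⇒≤ t<n)

coeff-J⊛ : ∀ n t σ (Y : GA n) (f : (ℕ → ℕ) → ℕ) → t ≤ n → (∀ ρ → coeff ρ Y ≡ + f ρ) →
           coeff σ (J n t ⊛ Y) ≡ + Σ (pred t) (λ j → f (tr (suc j) t ∘ σ))
coeff-J⊛ n t σ Y f t≤n coeffY = begin
  coeff σ (J n t ⊛ Y)                 ≡⟨ Φ-tabulate n id _ (λ a → Σ n (w a))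
                                           (λ u → Φ-tabulate n id _ (w (toℕ u)) (term u) refl) refl ⟩
  + Σ n (λ a → Σ n (w a))             ≡⟨ cong +_ (Σ-J-indices n t F t≤n) ⟩
  + Σ (pred t) (F (pred t))           ≡⟨ cong +_ (relabel t) ⟩
  + Σ (pred t) (λ j → f (tr (suc j) t ∘ σ)) ∎
  where
  open ≡-Reasoning
  Φ : GA n → ℤ
  Φ x = coeff σ (x ⊛ Y)
  open Additive Φ (λ x y → trans (cong (coeff σ) (Listₚ.concatMap-++ _ x y)) (coeff-++ σ (x ⊛ Y) (y ⊛ Y)))
  F : ℕ → ℕ → ℕ
  F a b = f (tr (suc b) (suc a) ∘ σ)
  w : ℕ → ℕ → ℕ
  w a b = if ⌊ suc a ≟ t ⌋ ∧ ⌊ suc b <? t ⌋ then F a b else 0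
  term : ∀ (u s : Fin n) → Φ (if ⌊ label u ≟ t ⌋ ∧ ⌊ label s <? t ⌋ then (+ 1 , transp s u) ∷ [] else [])
                         ≡ + w (toℕ u) (toℕ s)
  term u s with ⌊ label u ≟ t ⌋ ∧ ⌊ label s <? t ⌋
  ... | true  = trans (coeff-transp⊛ s u σ Y) (coeffY _)
  ... | false = refl
  relabel : ∀ t → Σ (pred t) (F (pred t)) ≡ Σ (pred t) (λ j → f (tr (suc j) t ∘ σ))
  relabel zero    = refl
  relabel (suc t) = refl

coeff-JProd : ∀ n ts σ → All (_≤ n) ts → coeff σ (JProd n ts) ≡ + paths n ts σ
coeff-JProd n []       σ []           = trans (ℤₚ.+-identityʳ _) (lift (⌊ represents? {n} id σ ⌋))
  where
  lift : ∀ c → (if c then + 1 else + 0) ≡ + (if c then 1 else 0)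
  lift true  = refl
  lift false = refl
coeff-JProd n (t ∷ ts) σ (t≤n ∷ ts≤n) =
  coeff-J⊛ n t σ (JProd n ts) (paths n ts) t≤n (λ ρ → coeff-JProd n ts ρ ts≤n)

exc : (ℕ → ℕ) → ℕ → ℕ
exc σ x = if ⌊ x <? σ x ⌋ then 1 else 0

exc≤1 : ∀ σ x → exc σ x ≤ 1
exc≤1 σ x with ⌊ x <? σ x ⌋
... | true  = s≤s z≤n
... | false = z≤n

exc-mono : ∀ σ ρ x → (x < σ x → x < ρ x) → exc σ x ≤ exc ρ x
exc-mono σ ρ x f with x <? σ x
... | yes x<σx = ℕₚ.≤-reflexive (sym (if-holds (x <? ρ x) (f x<σx)))
... | no _     = z≤n

length-snoc : ∀ (xs : List ℕ) T → length (xs ∷ʳ T) ≡ suc (length xs)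
length-snoc xs T = trans (Listₚ.length-++ xs) (ℕₚ.+-comm (length xs) 1)

module Counting (n : ℕ) where

  Pt : ℕ → Set
  Pt x = 0 < x × x ≤ n

  IsId : (ℕ → ℕ) → Set
  IsId ρ = ∀ x → Pt x → x ≡ ρ x

  represents→isId : ∀ ρ → Represents {n} id ρ → IsId ρ
  represents→isId ρ r (suc x) (_ , x<n) =
    subst (λ y → y ≡ ρ y) (cong suc (Finₚ.toℕ-fromℕ< x<n)) (r (Fin.fromℕ< x<n))

  isId→represents : ∀ ρ → IsId ρ → Represents {n} id ρ
  isId→represents ρ h i = h (label i) (s≤s z≤n , Finₚ.toℕ<n i)

  paths-[]-id : ∀ ρ → IsId ρ → paths n [] ρ ≡ 1
  paths-[]-id ρ h = if-holds (represents? id ρ) (isId→represents ρ h)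

  paths-[]-nonid : ∀ ρ → ¬ IsId ρ → paths n [] ρ ≡ 0
  paths-[]-nonid ρ ¬h = if-fails (represents? id ρ) (¬h ∘ represents→isId ρ)

  paths-[]-iff : ∀ ρ ρ′ → (IsId ρ → IsId ρ′) → (IsId ρ′ → IsId ρ) → paths n [] ρ ≡ paths n [] ρ′
  paths-[]-iff ρ ρ′ f g = cong (λ c → if c then 1 else 0) (dec-iff (represents? id ρ) (represents? id ρ′)
    (isId→represents ρ′ ∘ f ∘ represents→isId ρ) (isId→represents ρ ∘ g ∘ represents→isId ρ′))

  paths-cong : ∀ ts {σ σ′} → (∀ x → σ x ≡ σ′ x) → paths n ts σ ≡ paths n ts σ′
  paths-cong []       h = paths-[]-iff _ _ (λ i x p → trans (i x p) (h x)) (λ i x p → trans (i x p) (sym (h x)))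
  paths-cong (t ∷ ts) h = Σ-cong (pred t) (λ j _ → paths-cong ts (cong (tr (suc j) t) ∘ h))

  paths-[]-conj : ∀ a b σ → Pt a → Pt b → paths n [] (tr a b ∘ σ) ≡ paths n [] (σ ∘ tr a b)
  paths-[]-conj a b σ pa pb = paths-[]-iff _ _ (λ h x px → swap-sides x (h (tr a b x) (image x px)))
    (λ h x px → trans (sym (tr-invol a b x)) (cong (tr a b) (trans (h (tr a b x) (image x px)) (cong σ (tr-invol a b x)))))
    where
    image : ∀ x → Pt x → Pt (tr a b x)
    image x = tr-preserves Pt a b x pa pb
    swap-sides : ∀ x → tr a b x ≡ tr a b (σ (tr a b x)) → x ≡ σ (tr a b x)
    swap-sides x e = trans (sym (tr-invol a b x)) (trans (cong (tr a b) e) (tr-invol a b _))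

  paths-snoc : ∀ ts T σ → T ≤ n → paths n (ts ∷ʳ T) σ ≡ Σ (pred T) (λ j → paths n ts (σ ∘ tr (suc j) T))
  paths-snoc []       T σ T≤n = Σ-cong (pred T) (λ j j<T-1 → let 1+j<T = below-pred j T j<T-1 in
    paths-[]-conj (suc j) T σ (s≤s z≤n , ℕₚ.≤-trans (ℕₚ.<⇒≤ 1+j<T) T≤n)
                              (ℕₚ.<-trans (s≤s z≤n) 1+j<T , T≤n))
  paths-snoc (t ∷ ts) T σ T≤n =
    trans (Σ-cong (pred t) (λ j _ → paths-snoc ts T (tr (suc j) t ∘ σ) T≤n)) (Σ-swap (pred t) (pred T) _)

  -- A point x above every t_i can never be moved by (s₁ t₁)⋯(s_k t_k), so σ must fix it.
  paths-moved : ∀ ts σ x → Pt x → All (_< x) ts → σ x ≢ x → paths n ts σ ≡ 0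
  paths-moved []       σ x px _            σx≢x = paths-[]-nonid σ (λ h → σx≢x (sym (h x px)))
  paths-moved (t ∷ ts) σ x px (t<x ∷ ts<x) σx≢x = Σ-zero (pred t) (λ j j<t-1 →
    paths-moved ts _ x px ts<x (λ e → σx≢x (trans (sym (tr-invol (suc j) t (σ x)))
      (trans (cong (tr (suc j) t) e) (tr-other (suc j) t x (x≢ j j<t-1) (λ x≡t → ℕₚ.<-irrefl (sym x≡t) t<x))))))
    where
    x≢ : ∀ j → j < pred t → x ≢ suc j
    x≢ j j<t-1 refl = ℕₚ.<-asym t<x (below-pred j t j<t-1)

  E : (ℕ → ℕ) → ℕ
  E σ = Σ n (λ j → exc σ (suc j))

  E-id : ∀ ρ → IsId ρ → E ρ ≡ 0
  E-id ρ h = Σ-zero n (λ j j<n →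
    if-fails (suc j <? ρ (suc j)) (ℕₚ.<-irrefl (h (suc j) (s≤s z≤n , j<n))))

  keeps-exc-but-b : ∀ (σ : ℕ → ℕ) a b x → a < σ b → x ≢ b → x < σ x → x < σ (tr a b x)
  keeps-exc-but-b σ a b x a<σb x≢b x<σx with trCase a b x
  ... | at-a refl       = subst (λ y → x < σ y) (sym (tr-a x b)) a<σb
  ... | at-b x≡b _      = ⊥-elim (x≢b x≡b)
  ... | other x≢a x≢b′  = subst (λ y → x < σ y) (sym (tr-other a b x x≢a x≢b′)) x<σx

  keeps-exc-but-a : ∀ (σ : ℕ → ℕ) a b x → σ b ≤ a → a < b → x ≢ a → x < σ x → x < σ (tr a b x)
  keeps-exc-but-a σ a b x σb≤a a<b x≢a x<σx with trCase a b x
  ... | at-a x≡a       = ⊥-elim (x≢a x≡a)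
  ... | at-b refl _    = ⊥-elim (ℕₚ.<-asym (ℕₚ.≤-<-trans σb≤a a<b) x<σx)
  ... | other x≢a′ x≢b = subst (λ y → x < σ y) (sym (tr-other a b x x≢a′ x≢b)) x<σx

  E-step : ∀ σ a b → a < b → E σ ≤ suc (E (σ ∘ tr a b))
  E-step σ a b a<b with a <? σ b
  ... | yes a<σb = Σ-mono-but-one n (pred b) (λ j _ j≢ → exc-mono σ (σ ∘ tr a b) (suc j)
                     (keeps-exc-but-b σ a b (suc j) a<σb (λ e → j≢ (cong pred e))))
                     (λ j → ℕₚ.≤-trans (exc≤1 σ (suc j)) (s≤s z≤n))
  ... | no a≮σb  = Σ-mono-but-one n (pred a) (λ j _ j≢ → exc-mono σ (σ ∘ tr a b) (suc j)
                     (keeps-exc-but-a σ a b (suc j) (ℕₚ.≮⇒≥ a≮σb) a<b (λ e → j≢ (cong pred e))))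
                     (λ j → ℕₚ.≤-trans (exc≤1 σ (suc j)) (s≤s z≤n))

  E-keep : ∀ σ a b → σ b ≤ b → a < σ b → E σ ≤ E (σ ∘ tr a b)
  E-keep σ a b σb≤b a<σb = Σ-mono n (λ j _ → exc-mono σ (σ ∘ tr a b) (suc j) (λ x<σx →
    keeps-exc-but-b σ a b (suc j) a<σb (λ { refl → ℕₚ.<⇒≱ x<σx σb≤b }) x<σx))

  -- Each factor (s t) destroys at most one excedance, so fewer factors than
  -- excedances cannot multiply to σ.
  paths-excedances : ∀ ts σ → All (_≤ n) ts → length ts < E σ → paths n ts σ ≡ 0
  paths-excedances ts = go (reverseView ts)
    where
    go : ∀ {ts} → Reverse ts → ∀ σ → All (_≤ n) ts → length ts < E σ → paths n ts σ ≡ 0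
    go []              σ _     0<E = paths-[]-nonid σ (λ h → ℕₚ.<-irrefl (sym (E-id σ h)) 0<E)
    go (ts ∶ rs ∶ʳ T) σ ts≤n k<E = trans (paths-snoc ts T σ (proj₂ (Allₚ.∷ʳ⁻ ts≤n)))
      (Σ-zero (pred T) (λ j j<T-1 → go rs _ (proj₁ (Allₚ.∷ʳ⁻ ts≤n)) (ℕₚ.≤-pred (begin-strict
        suc (length ts)                    ≡⟨ sym (length-snoc ts T) ⟩
        length (ts ∷ʳ T)                   <⟨ k<E ⟩
        E σ                                ≤⟨ E-step σ (suc j) T (below-pred j T j<T-1) ⟩
        suc (E (σ ∘ tr (suc j) T))         ∎))))
      where open ℕₚ.≤-Reasoning

-- The permutation σ_μ.  sigmaFrom c (m ∷ ms) is the cycle (c, c+1, …, c+m) followed by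
-- the blocks of ms starting at c + m + 1; a block of length 0 is a fixed point.

-- The number of points covered by the blocks of ms.
span : List ℕ → ℕ
span []       = 0
span (m ∷ ms) = suc (m + span ms)

span-sum : ∀ ms → span ms ≡ sum ms + length ms
span-sum []       = refl
span-sum (m ∷ ms) rewrite span-sum ms =
  sym (trans (ℕₚ.+-suc (m + sum ms) (length ms)) (cong suc (ℕₚ.+-assoc m (sum ms) (length ms))))

sum-snoc : ∀ pre k → sum (pre ∷ʳ k) ≡ sum pre + k
sum-snoc pre k = trans (Sumₚ.sum-++ pre (k ∷ [])) (cong (_+_ (sum pre)) (ℕₚ.+-identityʳ k))

span-++ : ∀ xs ys → span (xs ++ ys) ≡ span xs + span ys
span-++ []       ys = refl
span-++ (m ∷ xs) ys = cong suc (trans (cong (_+_ m) (span-++ xs ys)) (sym (ℕₚ.+-assoc m (span xs) (span ys))))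

next-start : ∀ c m s → c + m + 1 + s ≡ c + suc (m + s)
next-start = solve-∀

block-inside : ∀ d m rest x → d ≤ x → x < d + m → sigmaFrom d (m ∷ rest) x ≡ suc x
block-inside d m rest x d≤x x<d+m rewrite ⌊⌋-true (d ≤? x) d≤x | ⌊⌋-true (x <? d + m) x<d+m = refl

block-end : ∀ d m rest → sigmaFrom d (m ∷ rest) (d + m) ≡ d
block-end d m rest
  rewrite ⌊⌋-true (d ≤? d + m) (ℕₚ.m≤m+n d m) | ⌊⌋-false (d + m <? d + m) (ℕₚ.<-irrefl refl)
        | ⌊⌋-true (d + m ≟ d + m) refl = refl

block-below : ∀ d m rest x → x < d → sigmaFrom d (m ∷ rest) x ≡ sigmaFrom (d + m + 1) rest x
block-below d m rest x x<d
  rewrite ⌊⌋-false (d ≤? x) (ℕₚ.<⇒≱ x<d)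
        | ⌊⌋-false (x ≟ d + m) (λ e → ℕₚ.<⇒≱ x<d (subst (d ≤_) (sym e) (ℕₚ.m≤m+n d m))) = refl

block-above : ∀ d m rest x → d + m < x → sigmaFrom d (m ∷ rest) x ≡ sigmaFrom (d + m + 1) rest x
block-above d m rest x d+m<x
  rewrite ⌊⌋-true (d ≤? x) (ℕₚ.≤-trans (ℕₚ.m≤m+n d m) (ℕₚ.<⇒≤ d+m<x))
        | ⌊⌋-false (x <? d + m) (ℕₚ.<-asym d+m<x)
        | ⌊⌋-false (x ≟ d + m) (λ e → ℕₚ.<-irrefl (sym e) d+m<x) = refl

sigma-below : ∀ c ms x → x < c → sigmaFrom c ms x ≡ x
sigma-below c []       x _   = refl
sigma-below c (m ∷ ms) x x<c =
  trans (block-below c m ms x x<c)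
        (sigma-below (c + m + 1) ms x (ℕₚ.<-≤-trans x<c (ℕₚ.≤-trans (ℕₚ.m≤m+n c m) (ℕₚ.m≤m+n (c + m) 1))))

beyond-first : ∀ c m ms x → c + span (m ∷ ms) ≤ x → c + m < x
beyond-first c m ms x le =
  ℕₚ.<-≤-trans (subst (c + m <_) (sym (ℕₚ.+-suc c m)) ℕₚ.≤-refl)
               (ℕₚ.≤-trans (ℕₚ.+-monoʳ-≤ c (s≤s (ℕₚ.m≤m+n m (span ms)))) le)

sigma-above : ∀ c ms x → c + span ms ≤ x → sigmaFrom c ms x ≡ x
sigma-above c []       x _  = refl
sigma-above c (m ∷ ms) x le = trans (block-above c m ms x (beyond-first c m ms x le))
  (sigma-above (c + m + 1) ms x (subst (_≤ x) (sym (next-start c m (span ms))) le))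

sigma-++-below : ∀ c pre rest x → x < c + span pre → sigmaFrom c (pre ++ rest) x ≡ sigmaFrom c pre x
sigma-++-below c []        rest x lt = sigma-below c rest x (subst (x <_) (ℕₚ.+-identityʳ c) lt)
sigma-++-below c (m ∷ pre) rest x lt =
  cong (λ z → if ⌊ c ≤? x ⌋ ∧ ⌊ x <? c + m ⌋ then suc x else (if ⌊ x ≟ c + m ⌋ then c else z))
       (sigma-++-below (c + m + 1) pre rest x (subst (x <_) (sym (next-start c m (span pre))) lt))

sigma-++-above : ∀ c pre rest x → c + span pre ≤ x → sigmaFrom c (pre ++ rest) x ≡ sigmaFrom (c + span pre) rest x
sigma-++-above c []        rest x le = cong (λ z → sigmaFrom z rest x) (sym (ℕₚ.+-identityʳ c))
sigma-++-above c (m ∷ pre) rest x le = begin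
  sigmaFrom c (m ∷ pre ++ rest) x                ≡⟨ block-above c m (pre ++ rest) x (beyond-first c m pre x le) ⟩
  sigmaFrom (c + m + 1) (pre ++ rest) x          ≡⟨ sigma-++-above (c + m + 1) pre rest x
                                                      (subst (_≤ x) (sym (next-start c m (span pre))) le) ⟩
  sigmaFrom (c + m + 1 + span pre) rest x        ≡⟨ cong (λ z → sigmaFrom z rest x) (next-start c m (span pre)) ⟩
  sigmaFrom (c + span (m ∷ pre)) rest x          ∎
  where open ≡-Reasoning

sigma-empty-block : ∀ d x → sigmaFrom d (0 ∷ []) x ≡ x
sigma-empty-block d x with ℕₚ.<-cmp x (d + 0)
... | tri< x<d _ _ = block-below d 0 [] x (subst (x <_) (ℕₚ.+-identityʳ d) x<d)
... | tri≈ _ refl _ = trans (block-end d 0 []) (sym (ℕₚ.+-identityʳ d))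
... | tri> _ _ d<x = block-above d 0 [] x d<x

sigma-drop-empty : ∀ c pre x → sigmaFrom c (pre ++ 0 ∷ []) x ≡ sigmaFrom c pre x
sigma-drop-empty c pre x with x <? c + span pre
... | yes x<d = sigma-++-below c pre (0 ∷ []) x x<d
... | no x≮d  = trans (sigma-++-above c pre (0 ∷ []) x d≤x)
                      (trans (sigma-empty-block (c + span pre) x) (sym (sigma-above c pre x d≤x)))
  where d≤x = ℕₚ.≮⇒≥ x≮d

second-end : ∀ d i r → d + i + 1 + r ≡ d + (i + suc r)
second-end = solve-∀

-- Splitting a cycle by a transposition:
-- (d, …, d+i)(d+i+1, …, d+i+1+r) = (d, …, d+i+1+r) ∘ (d+i  d+i+1+r).
split-block : ∀ d i r x → d ≤ x →
  sigmaFrom d (i ∷ r ∷ []) x ≡ sigmaFrom d ((i + suc r) ∷ []) (tr (d + i) (d + (i + suc r)) x)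
split-block d i r x d≤x with trCase (d + i) (d + (i + suc r)) x
... | at-a refl = begin
  sigmaFrom d (i ∷ r ∷ []) (d + i)        ≡⟨ block-end d i (r ∷ []) ⟩
  d                                       ≡⟨ sym (block-end d (i + suc r) []) ⟩
  sigmaFrom d ((i + suc r) ∷ []) e        ≡⟨ cong (sigmaFrom d ((i + suc r) ∷ [])) (sym (tr-a (d + i) e)) ⟩
  sigmaFrom d ((i + suc r) ∷ []) (tr (d + i) e (d + i)) ∎
  where open ≡-Reasoning; e = d + (i + suc r)
... | at-b refl _ = begin
  sigmaFrom d (i ∷ r ∷ []) e              ≡⟨ block-above d i (r ∷ []) e a<e ⟩
  sigmaFrom (d + i + 1) (r ∷ []) e        ≡⟨ cong (sigmaFrom (d + i + 1) (r ∷ [])) (sym (second-end d i r)) ⟩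
  sigmaFrom (d + i + 1) (r ∷ []) (d + i + 1 + r) ≡⟨ block-end (d + i + 1) r [] ⟩
  d + i + 1                               ≡⟨ ℕₚ.+-comm (d + i) 1 ⟩
  suc (d + i)                             ≡⟨ sym (block-inside d (i + suc r) [] (d + i) (ℕₚ.m≤m+n d i) a<e) ⟩
  sigmaFrom d ((i + suc r) ∷ []) (d + i)  ≡⟨ cong (sigmaFrom d ((i + suc r) ∷ [])) (sym (tr-b (d + i) e)) ⟩
  sigmaFrom d ((i + suc r) ∷ []) (tr (d + i) e e) ∎
  where open ≡-Reasoning; e = d + (i + suc r)
        a<e : d + i < e
        a<e = ℕₚ.+-monoʳ-< d (ℕₚ.m<m+n i (s≤s z≤n))
... | other x≢a x≢e rewrite tr-other (d + i) (d + (i + suc r)) x x≢a x≢e = fixed-by-tr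
  where
  e : ℕ
  e = d + (i + suc r)
  fixed-by-tr : sigmaFrom d (i ∷ r ∷ []) x ≡ sigmaFrom d ((i + suc r) ∷ []) x
  fixed-by-tr with ℕₚ.<-cmp x (d + i) | ℕₚ.<-cmp x e
  ... | tri< x<a _ _ | _ = trans (block-inside d i (r ∷ []) x d≤x x<a)
                             (sym (block-inside d (i + suc r) [] x d≤x
                                    (ℕₚ.<-trans x<a (ℕₚ.+-monoʳ-< d (ℕₚ.m<m+n i (s≤s z≤n))))))
  ... | tri≈ _ x≡a _ | _ = ⊥-elim (x≢a x≡a)
  ... | tri> _ _ _   | tri≈ _ x≡e _ = ⊥-elim (x≢e x≡e)
  ... | tri> _ _ a<x | tri< x<e _ _ = trans (block-above d i (r ∷ []) x a<x)
         (trans (block-inside (d + i + 1) r [] x (subst (_≤ x) (ℕₚ.+-comm 1 (d + i)) a<x)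
                               (subst (x <_) (sym (second-end d i r)) x<e))
                (sym (block-inside d (i + suc r) [] x d≤x x<e)))
  ... | tri> _ _ a<x | tri> _ _ e<x = trans (block-above d i (r ∷ []) x a<x)
         (trans (sigma-above (d + i + 1) (r ∷ []) x (subst (_≤ x) (sym (beyond-second d i r)) e<x))
                (sym (sigma-above d ((i + suc r) ∷ []) x (subst (_≤ x) (sym (beyond-whole d (i + suc r))) e<x))))
    where
    beyond-second : ∀ d i r → d + i + 1 + suc (r + 0) ≡ suc (d + (i + suc r))
    beyond-second = solve-∀
    beyond-whole : ∀ d m → d + suc (m + 0) ≡ suc (d + m)
    beyond-whole = solve-∀

sigma-split : ∀ c pre i r x → sigmaFrom c (pre ++ i ∷ r ∷ []) x
            ≡ sigmaFrom c (pre ++ (i + suc r) ∷ []) (tr (c + span pre + i) (c + span pre + (i + suc r)) x)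
sigma-split c pre i r x with x <? c + span pre
... | yes x<d = trans (sigma-++-below c pre _ x x<d) (sym (trans
      (cong (sigmaFrom c (pre ++ (i + suc r) ∷ [])) (tr-other _ _ x (below i) (below (i + suc r))))
      (sigma-++-below c pre _ x x<d)))
  where
  below : ∀ k → x ≢ c + span pre + k
  below k e = ℕₚ.<⇒≱ x<d (subst (c + span pre ≤_) (sym e) (ℕₚ.m≤m+n _ k))
... | no x≮d = trans (sigma-++-above c pre _ x d≤x) (trans (split-block d i r x d≤x)
      (sym (sigma-++-above c pre _ _ (tr-preserves (d ≤_) _ _ x (ℕₚ.m≤m+n d i) (ℕₚ.m≤m+n d (i + suc r)) d≤x))))
  where
  d : ℕ
  d = c + span pre
  d≤x : d ≤ x
  d≤x = ℕₚ.≮⇒≥ x≮d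

-- Inside a block (c, …, c+m) the points c, …, c+m-1 are excedances, so σ_μ has at
-- least |μ| excedances (stated for any ρ agreeing with σ on the blocks).
excedances-in-blocks : ∀ c ms ρ → (∀ x → c ≤ x → x < c + span ms → ρ x ≡ sigmaFrom c ms x) →
                       sum ms ≤ Σ (span ms) (λ j → exc ρ (c + j))
excedances-in-blocks c []       ρ agree = z≤n
excedances-in-blocks c (m ∷ ms) ρ agree =
  subst (sum (m ∷ ms) ≤_) (sym (Σ-split (suc m) (span ms) (λ j → exc ρ (c + j))))
        (ℕₚ.+-mono-≤ first-block later-blocks)
  where
  inside : ∀ j → j < m → c + j < ρ (c + j)
  inside j j<m = ℕₚ.≤-reflexive (sym (trans
    (agree (c + j) (ℕₚ.m≤m+n c j)
           (ℕₚ.+-monoʳ-< c (ℕₚ.<-≤-trans j<m (ℕₚ.≤-trans (ℕₚ.m≤m+n m (span ms)) (ℕₚ.n≤1+n _)))))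
    (block-inside c m ms (c + j) (ℕₚ.m≤m+n c j) (ℕₚ.+-monoʳ-< c j<m))))
  first-block : m ≤ Σ (suc m) (λ j → exc ρ (c + j))
  first-block = begin
    m                               ≡⟨ sym (Σ-const1 m) ⟩
    Σ m (λ _ → 1)                   ≡⟨ Σ-cong m (λ j j<m → sym (if-holds (c + j <? ρ (c + j)) (inside j j<m))) ⟩
    Σ m (λ j → exc ρ (c + j))       ≤⟨ Σ-prefix m (suc m) _ (ℕₚ.n≤1+n m) ⟩
    Σ (suc m) (λ j → exc ρ (c + j)) ∎
    where open ℕₚ.≤-Reasoning
  later-blocks : sum ms ≤ Σ (span ms) (λ j → exc ρ (c + (suc m + j)))
  later-blocks = subst (sum ms ≤_) (Σ-cong (span ms) (λ j _ → cong (exc ρ) (next-start c m j)))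
    (excedances-in-blocks (c + m + 1) ms ρ (λ x c′≤x x<end → trans
      (agree x (ℕₚ.≤-trans (ℕₚ.≤-trans (ℕₚ.m≤m+n c m) (ℕₚ.m≤m+n (c + m) 1)) c′≤x)
               (subst (x <_) (next-start c m (span ms)) x<end))
      (block-above c m ms x (subst (_≤ x) (ℕₚ.+-comm (c + m) 1) c′≤x))))

excedances-sigma : ∀ n ms → span ms ≤ n → sum ms ≤ Counting.E n (sigmaFrom 1 ms)
excedances-sigma n ms span≤n = ℕₚ.≤-trans (excedances-in-blocks 1 ms (sigmaFrom 1 ms) (λ _ _ _ → refl))
                                          (Σ-prefix (span ms) n _ span≤n)

-- The (p+1)-st entry of a list (0 beyond its end).
at : List ℕ → ℕ → ℕ
at []       _       = 0
at (x ∷ xs) zero    = x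
at (x ∷ xs) (suc p) = at xs p

InEᶠ : ℕ → ℕ → (ℕ → ℕ) → Set
InEᶠ a r v = (∀ p → suc p < r → a + suc p ≤ v p) × (∀ p → suc p ≡ r → v p ≡ a + r)

InEᶠ-cong : ∀ a r {v w : ℕ → ℕ} → (∀ p → p < r → v p ≡ w p) → InEᶠ a r v → InEᶠ a r w
InEᶠ-cong a r v≗w (low , last) =
  (λ p lt → subst (a + suc p ≤_) (v≗w p (ℕₚ.<-trans (ℕₚ.n<1+n p) lt)) (low p lt)) ,
  (λ p e → trans (sym (v≗w p (subst (p <_) e (ℕₚ.n<1+n p)))) (last p e))

InEᶠ-above : ∀ a r v → InEᶠ a r v → ∀ p → p < r → a + suc p ≤ v p
InEᶠ-above a r v (low , last) p p<r with ℕₚ.m≤n⇒m<n∨m≡n p<r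
... | inj₁ 1+p<r = low p 1+p<r
... | inj₂ 1+p≡r = ℕₚ.≤-reflexive (sym (trans (last p 1+p≡r) (cong (_+_ a) (sym 1+p≡r))))

Above : ℕ → ℕ → (ℕ → ℕ) → Set
Above d L v = ∀ p → p < L → d + suc p ≤ v p

Split : ℕ → ℕ → (ℕ → ℕ) → ℕ → Set
Split d L v i = InEᶠ d i v × InEᶠ (d + i + 1) (L ∸ i) (λ q → v (i + q))

data Side (p i : ℕ) : Set where
  left  : p < i → Side p i
  right : ∀ q → p ≡ i + q → Side p i

side : ∀ p i → Side p i
side p i with p <? i
... | yes p<i = left p<i
... | no p≮i  = right (p ∸ i) (sym (ℕₚ.m+[n∸m]≡n (ℕₚ.≮⇒≥ p≮i)))

right-offset : ∀ i q L → i ≤ L → i + q < L → q < L ∸ i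
right-offset i q L i≤L lt = ℕₚ.+-cancelˡ-< i q (L ∸ i) (subst (i + q <_) (sym (ℕₚ.m+[n∸m]≡n i≤L)) lt)

right-bound : ∀ d i q → d + i + 1 + suc q ≡ suc (d + suc (i + q))
right-bound = solve-∀

split-above : ∀ d L v i → i ≤ L → Split d L v i → Above d L v
split-above d L v i i≤L (l , r) p p<L with side p i
... | left p<i       = InEᶠ-above d i v l p p<i
... | right q refl   = ℕₚ.≤-trans (ℕₚ.n≤1+n _) (subst (_≤ v (i + q)) (right-bound d i q)
                         (InEᶠ-above (d + i + 1) (L ∸ i) _ r q (right-offset i q L i≤L p<L)))

-- A sequence cannot be split at two places i < j: the cut at j needs v (j-1) = d + j,
-- which is below the bound imposed there by the right part of the cut at i.
two-cuts : ∀ d L v i j → i ≤ L → j ≤ L → i < j → Split d L v i → Split d L v j → ⊥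
two-cuts d L v i (suc j′) i≤L j≤L i<j (_ , rᵢ) ((_ , lastⱼ) , _) with side j′ i
... | left j′<i    = ℕₚ.<⇒≱ j′<i (ℕₚ.≤-pred i<j)
... | right q refl = ℕₚ.<-irrefl refl (begin-strict
      d + suc (i + q)  <⟨ subst (_≤ v (i + q)) (right-bound d i q)
                            (InEᶠ-above (d + i + 1) (L ∸ i) _ rᵢ q (right-offset i q L i≤L j≤L)) ⟩
      v (i + q)        ≡⟨ lastⱼ (i + q) refl ⟩
      d + suc (i + q)  ∎)
  where open ℕₚ.≤-Reasoning

split-unique : ∀ d L v i j → i ≤ L → j ≤ L → Split d L v i → Split d L v j → i ≡ j
split-unique d L v i j i≤L j≤L sᵢ sⱼ with ℕₚ.<-cmp i j
... | tri< i<j _ _ = ⊥-elim (two-cuts d L v i j i≤L j≤L i<j sᵢ sⱼ)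
... | tri≈ _ i≡j _ = i≡j
... | tri> _ _ j<i = ⊥-elim (two-cuts d L v j i j≤L i≤L j<i sⱼ sᵢ)

last-witness : ∀ N (Q : ℕ → Set) → (∀ j → Dec (Q j)) →
               ∃ λ i → i ≤ N × (i ≡ 0 ⊎ Q i) × (∀ j → i < j → j ≤ N → ¬ Q j)
last-witness zero    Q Q? = 0 , z≤n , inj₁ refl , λ j 0<j j≤0 _ → ℕₚ.<⇒≱ 0<j j≤0
last-witness (suc N) Q Q? with Q? (suc N)
... | yes q = suc N , ℕₚ.≤-refl , inj₂ q , λ j i<j j≤ _ → ℕₚ.<⇒≱ i<j j≤
... | no ¬q with last-witness N Q Q?
...   | i , i≤N , qᵢ , none-after = i , ℕₚ.m≤n⇒m≤1+n i≤N , qᵢ , none-after′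
  where
  none-after′ : ∀ j → i < j → j ≤ suc N → ¬ Q j
  none-after′ j i<j j≤1+N with j ≟ suc N
  ... | yes refl = ¬q
  ... | no j≢1+N = none-after j i<j (ℕₚ.≤-pred (ℕₚ.≤∧≢⇒< j≤1+N j≢1+N))

-- A sequence above the bounds of 𝔈(d; L+1) and below d + L + 1 splits at the last
-- position i where the bound is attained (i = 0 if it never is).
split-exists : ∀ d L v → (∀ p → p < L → v p ≤ d + suc L) → Above d L v → ∃ λ i → i ≤ L × Split d L v i
split-exists d L v v≤ above with last-witness L (λ j → v (pred j) ≡ d + j) (λ j → v (pred j) ≟ d + j)
... | i , i≤L , attained , none-after = i , i≤L , (low , last) , (low′ , last′)
  where
  low : ∀ p → suc p < i → d + suc p ≤ v p
  low p lt = above p (ℕₚ.≤-trans (ℕₚ.<-trans (ℕₚ.n<1+n p) lt) i≤L)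
  last : ∀ p → suc p ≡ i → v p ≡ d + i
  last p 1+p≡i = from-attained attained
    where
    from-attained : i ≡ 0 ⊎ v (pred i) ≡ d + i → v p ≡ d + i
    from-attained (inj₁ i≡0)   = ⊥-elim (ℕₚ.1+n≢0 (trans 1+p≡i i≡0))
    from-attained (inj₂ v≡d+i) = subst (λ z → v z ≡ d + i) (cong pred (sym 1+p≡i)) v≡d+i
  strict : ∀ q → i + q < L → suc (d + suc (i + q)) ≤ v (i + q)
  strict q lt =
    ℕₚ.≤∧≢⇒< (above (i + q) lt) (λ e → none-after (suc (i + q)) (s≤s (ℕₚ.m≤m+n i q)) lt (sym e))
  low′ : ∀ q → suc q < L ∸ i → d + i + 1 + suc q ≤ v (i + q)
  low′ q lt = subst (_≤ v (i + q)) (sym (right-bound d i q))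
    (strict q (subst (i + q <_) (ℕₚ.m+[n∸m]≡n i≤L) (ℕₚ.+-monoʳ-< i (ℕₚ.<-trans (ℕₚ.n<1+n q) lt))))
  last′ : ∀ q → suc q ≡ L ∸ i → v (i + q) ≡ d + i + 1 + (L ∸ i)
  last′ q e = ℕₚ.≤-antisym
    (ℕₚ.≤-trans (v≤ (i + q) i+q<L)
                (ℕₚ.≤-reflexive (trans (cong (λ z → d + suc z) (sym (ℕₚ.m+[n∸m]≡n i≤L))) (end d i (L ∸ i)))))
    (subst (_≤ v (i + q)) (trans (sym (right-bound d i q)) (cong (_+_ (d + i + 1)) e)) (strict q i+q<L))
    where
    i+q<L : i + q < L
    i+q<L = subst (i + q <_) (ℕₚ.m+[n∸m]≡n i≤L) (ℕₚ.+-monoʳ-< i (subst (q <_) e (ℕₚ.n<1+n q)))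
    end : ∀ d i r → d + suc (i + r) ≡ d + i + 1 + r
    end = solve-∀

Sorted : List ℕ → Set
Sorted = Linked _≤_

lookup-at : ∀ xs (f : Fin (length xs)) → lookup xs f ≡ at xs (toℕ f)
lookup-at (x ∷ xs) Fin.zero    = refl
lookup-at (x ∷ xs) (Fin.suc f) = lookup-at xs f

InE→InEᶠ : ∀ a r xs → InE a r xs → InEᶠ a r (at xs)
InE→InEᶠ a r xs (len , _ , low , last) = low′ , last′
  where
  index : ∀ p → p < r → Σ[ f ∈ Fin (length xs) ] toℕ f ≡ p
  index p p<r = Fin.fromℕ< (subst (p <_) (sym len) p<r) , Finₚ.toℕ-fromℕ< _
  low′ : ∀ p → suc p < r → a + suc p ≤ at xs p
  low′ p lt with index p (ℕₚ.<-trans (ℕₚ.n<1+n p) lt)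
  ... | f , refl = subst (a + suc (toℕ f) ≤_) (lookup-at xs f) (low f lt)
  last′ : ∀ p → suc p ≡ r → at xs p ≡ a + r
  last′ p e with index p (subst (p <_) e (ℕₚ.n<1+n p))
  ... | f , refl = trans (sym (lookup-at xs f)) (last f e)

InEᶠ→InE : ∀ a r xs → length xs ≡ r → Sorted xs → InEᶠ a r (at xs) → InE a r xs
InEᶠ→InE a r xs len sorted (low , last) = len , sorted ,
  (λ f lt → subst (a + suc (toℕ f) ≤_) (sym (lookup-at xs f)) (low (toℕ f) lt)) ,
  (λ f e → trans (lookup-at xs f) (last (toℕ f) e))

at-take : ∀ i xs p → p < i → at (take i xs) p ≡ at xs p
at-take (suc i) []       p       _         = refl
at-take (suc i) (x ∷ xs) zero    _         = refl
at-take (suc i) (x ∷ xs) (suc p) (s≤s p<i) = at-take i xs p p<i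

at-drop : ∀ i xs q → at (drop i xs) q ≡ at xs (i + q)
at-drop zero    xs       q = refl
at-drop (suc i) []       q = refl
at-drop (suc i) (x ∷ xs) q = at-drop i xs q

at-init : ∀ xs T p → p < length xs → at (xs ∷ʳ T) p ≡ at xs p
at-init (x ∷ xs) T zero    _         = refl
at-init (x ∷ xs) T (suc p) (s≤s p<l) = at-init xs T p p<l

at-last : ∀ xs T → at (xs ∷ʳ T) (length xs) ≡ T
at-last []       T = refl
at-last (x ∷ xs) T = at-last xs T

all-at : ∀ {P : ℕ → Set} xs → All P xs → ∀ p → p < length xs → P (at xs p)
all-at (x ∷ xs) (px ∷ _)   zero    _        = px
all-at (x ∷ xs) (_  ∷ pxs) (suc p) (s≤s lt) = all-at xs pxs p lt

sorted-take : ∀ i xs → Sorted xs → Sorted (take i xs)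
sorted-take i xs = Linkedₚ.AllPairs⇒Linked ∘ AllPairsₚ.take⁺ i ∘ Linkedₚ.Linked⇒AllPairs ℕₚ.≤-trans

sorted-drop : ∀ i xs → Sorted xs → Sorted (drop i xs)
sorted-drop i xs = Linkedₚ.AllPairs⇒Linked ∘ AllPairsₚ.drop⁺ i ∘ Linkedₚ.Linked⇒AllPairs ℕₚ.≤-trans

sorted-snoc⁻ : ∀ xs {T} → Sorted (xs ∷ʳ T) → Sorted xs × All (_≤ T) xs
sorted-snoc⁻ []           _         = [] , []
sorted-snoc⁻ (x ∷ [])     (x≤T ∷ _) = [-] , x≤T ∷ []
sorted-snoc⁻ (x ∷ y ∷ xs) (x≤y ∷ s) with sorted-snoc⁻ (y ∷ xs) s
... | s′ , (y≤T ∷ ys≤T) = x≤y ∷ s′ , ℕₚ.≤-trans x≤y y≤T ∷ y≤T ∷ ys≤T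

take-prefix : ∀ m K (ts : List ℕ) → take m (take (m + K) ts) ≡ take m ts
take-prefix m K ts =
  trans (Listₚ.take-take m (m + K) ts) (cong (λ z → take z ts) (ℕₚ.m≤n⇒m⊓n≡m (ℕₚ.m≤m+n m K)))

blockCond-++ : ∀ c pre rest ts → BlockCond c (pre ++ rest) ts
             ⇔ (BlockCond c pre (take (sum pre) ts) × BlockCond (c + span pre) rest (drop (sum pre) ts))
blockCond-++ c []        rest ts = mk⇔ (λ b → tt , subst (λ z → BlockCond z rest ts) (sym (ℕₚ.+-identityʳ c)) b)
                                       (λ (_ , b) → subst (λ z → BlockCond z rest ts) (ℕₚ.+-identityʳ c) b)
blockCond-++ c (m ∷ pre) rest ts = mk⇔
  (λ (e , b) → let (b₁ , b₂) = to (blockCond-++ c′ pre rest (drop m ts)) b in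
     (subst (InE c m) (sym (take-prefix m K ts)) e , subst (BlockCond c′ pre) (Listₚ.take-drop K m ts) b₁) ,
     subst₂ (λ z w → BlockCond z rest w) (next-start c m (span pre)) (Listₚ.drop-drop m K ts) b₂)
  (λ ((e , b₁) , b₂) → subst (InE c m) (take-prefix m K ts) e ,
     from (blockCond-++ c′ pre rest (drop m ts)) (subst (BlockCond c′ pre) (sym (Listₚ.take-drop K m ts)) b₁ ,
       subst₂ (λ z w → BlockCond z rest w) (sym (next-start c m (span pre))) (sym (Listₚ.drop-drop m K ts)) b₂))
  where
  K  = sum pre
  c′ : ℕ
  c′ = c + m + 1
  open Equivalence

InE-empty : ∀ a → InE a 0 []
InE-empty a = refl , [] , (λ ()) , (λ ())

blockCond-drop-empty : ∀ c pre ts → length ts ≡ sum pre → BlockCond c (pre ++ 0 ∷ []) ts ⇔ BlockCond c pre ts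
blockCond-drop-empty c pre ts len = mk⇔
  (λ b → subst (BlockCond c pre) all (proj₁ (to (blockCond-++ c pre (0 ∷ []) ts) b)))
  (λ b → from (blockCond-++ c pre (0 ∷ []) ts) (subst (BlockCond c pre) (sym all) b , InE-empty _ , tt))
  where
  open Equivalence
  all : take (sum pre) ts ≡ ts
  all = Listₚ.take-all (sum pre) ts (ℕₚ.≤-reflexive len)

take-snoc : ∀ K (xs : List ℕ) T → K ≤ length xs → take K (xs ∷ʳ T) ≡ take K xs
take-snoc zero    xs       T _         = refl
take-snoc (suc K) (x ∷ xs) T (s≤s K≤l) = cong (x ∷_) (take-snoc K xs T K≤l)

drop-snoc : ∀ K (xs : List ℕ) T → K ≤ length xs → drop K (xs ∷ʳ T) ≡ drop K xs ∷ʳ T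
drop-snoc zero    xs       T _         = refl
drop-snoc (suc K) (x ∷ xs) T (s≤s K≤l) = drop-snoc K xs T K≤l

InE⇔ : ∀ a r xs → length xs ≡ r → Sorted xs → InE a r xs ⇔ InEᶠ a r (at xs)
InE⇔ a r xs len sorted = mk⇔ (InE→InEᶠ a r xs) (InEᶠ→InE a r xs len sorted)

InE-prefix⇔ : ∀ a i xs → i ≤ length xs → Sorted xs → InE a i (take i xs) ⇔ InEᶠ a i (at xs)
InE-prefix⇔ a i xs i≤l sorted = mk⇔
  (InEᶠ-cong a i (at-take i xs) ∘ to (InE⇔ a i (take i xs) len (sorted-take i xs sorted)))
  (from (InE⇔ a i (take i xs) len (sorted-take i xs sorted)) ∘ InEᶠ-cong a i (λ p p<i → sym (at-take i xs p p<i)))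
  where
  open Equivalence
  len : length (take i xs) ≡ i
  len = trans (Listₚ.length-take i xs) (ℕₚ.m≤n⇒m⊓n≡m i≤l)

InE-suffix⇔ : ∀ a i r xs → length xs ∸ i ≡ r → Sorted xs →
              InE a r (take r (drop i xs)) ⇔ InEᶠ a r (λ q → at xs (i + q))
InE-suffix⇔ a i r xs len-r sorted = mk⇔
  (InEᶠ-cong a r (λ q _ → at-drop i xs q) ∘ to suffix⇔ ∘ subst (InE a r) all)
  (subst (InE a r) (sym all) ∘ from suffix⇔ ∘ InEᶠ-cong a r (λ q _ → sym (at-drop i xs q)))
  where
  open Equivalence
  len : length (drop i xs) ≡ r
  len = trans (Listₚ.length-drop i xs) len-r
  all : take r (drop i xs) ≡ drop i xs
  all = Listₚ.take-all r (drop i xs) (ℕₚ.≤-reflexive len)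
  suffix⇔ : InE a r (drop i xs) ⇔ InEᶠ a r (at (drop i xs))
  suffix⇔ = InE⇔ a r (drop i xs) len (sorted-drop i xs sorted)

-- With the entries
-- ts ++ [T], the last block occupies the points d, …, d+m+1 and the entries vs ++ [T].

module LastBlock (pre : List ℕ) (m : ℕ) (ts : List ℕ) (T : ℕ)
                 (len : length ts ≡ sum pre + m) (sorted : Sorted (ts ∷ʳ T)) where

  K d : ℕ
  K = sum pre
  d = suc (span pre)

  vs : List ℕ
  vs = drop K ts

  K≤len : K ≤ length ts
  K≤len = subst (K ≤_) (sym len) (ℕₚ.m≤m+n K m)

  len-vs : length vs ≡ m
  len-vs = trans (Listₚ.length-drop K ts) (trans (cong (_∸ K) len) (ℕₚ.m+n∸m≡n K m))

  sorted-vsT : Sorted (vs ∷ʳ T)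
  sorted-vsT = subst Sorted (drop-snoc K ts T K≤len) (sorted-drop K (ts ∷ʳ T) sorted)

  sorted-vs : Sorted vs
  sorted-vs = proj₁ (sorted-snoc⁻ vs sorted-vsT)

  Front : Set
  Front = BlockCond 1 pre (take K ts)

  Whole : Set
  Whole = BlockCond 1 (pre ++ suc m ∷ []) (ts ∷ʳ T)

  Cut : ℕ → Set
  Cut i = BlockCond 1 (pre ++ i ∷ (m ∸ i) ∷ []) ts

  lastBlock⇔ : InE d (suc m) (vs ∷ʳ T) ⇔ (Above d m (at vs) × T ≡ d + suc m)
  lastBlock⇔ = mk⇔
    (λ e → let (low , last) = to entries⇔ e in
      (λ p p<m → subst (d + suc p ≤_) (at-init vs T p (in-vs p<m))
                       (InEᶠ-above d (suc m) _ (low , last) p (ℕₚ.m<n⇒m<1+n p<m))) ,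
      trans (sym (at-last vs T)) (last (length vs) (cong suc len-vs)))
    (λ (above , T≡) → from entries⇔
      ((λ p 1+p<1+m → let p<m = ℕₚ.≤-pred 1+p<1+m in
          subst (d + suc p ≤_) (sym (at-init vs T p (in-vs p<m))) (above p p<m)) ,
       (λ p 1+p≡1+m → subst (λ z → at (vs ∷ʳ T) z ≡ d + suc m) (trans len-vs (ℕₚ.suc-injective (sym 1+p≡1+m)))
                            (trans (at-last vs T) T≡))))
    where
    open Equivalence
    in-vs : ∀ {p} → p < m → p < length vs
    in-vs = subst (_ <_) (sym len-vs)
    entries⇔ : InE d (suc m) (vs ∷ʳ T) ⇔ InEᶠ d (suc m) (at (vs ∷ʳ T))
    entries⇔ = InE⇔ d (suc m) (vs ∷ʳ T) (trans (length-snoc vs T) (cong suc len-vs)) sorted-vsT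

  whole⇔ : Whole ⇔ (Front × Above d m (at vs) × T ≡ d + suc m)
  whole⇔ = mk⇔
    (λ b → let (b₁ , e , _) = to (blockCond-++ 1 pre (suc m ∷ []) (ts ∷ʳ T)) b in
       subst (BlockCond 1 pre) (take-snoc K ts T K≤len) b₁ , to lastBlock⇔ (subst (InE d (suc m)) entries e))
    (λ (b₁ , rest) → from (blockCond-++ 1 pre (suc m ∷ []) (ts ∷ʳ T))
       (subst (BlockCond 1 pre) (sym (take-snoc K ts T K≤len)) b₁ ,
        subst (InE d (suc m)) (sym entries) (from lastBlock⇔ rest) , tt))
    where
    open Equivalence
    entries : take (suc m) (drop K (ts ∷ʳ T)) ≡ vs ∷ʳ T
    entries = trans (cong (take (suc m)) (drop-snoc K ts T K≤len))
                    (Listₚ.take-all (suc m) (vs ∷ʳ T) (ℕₚ.≤-reflexive (trans (length-snoc vs T) (cong suc len-vs))))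

  cut⇔ : ∀ i → i ≤ m → Cut i ⇔ (Front × Split d m (at vs) i)
  cut⇔ i i≤m = mk⇔
    (λ b → let (b₁ , eₗ , eᵣ , _) = to (blockCond-++ 1 pre (i ∷ (m ∸ i) ∷ []) ts) b in
       b₁ , to first eₗ , to second eᵣ)
    (λ (b₁ , l , r) → from (blockCond-++ 1 pre (i ∷ (m ∸ i) ∷ []) ts) (b₁ , from first l , from second r , tt))
    where
    open Equivalence
    first : InE d i (take i vs) ⇔ InEᶠ d i (at vs)
    first = InE-prefix⇔ d i vs (subst (i ≤_) (sym len-vs) i≤m) sorted-vs
    second : InE (d + i + 1) (m ∸ i) (take (m ∸ i) (drop i vs)) ⇔ InEᶠ (d + i + 1) (m ∸ i) (λ q → at vs (i + q))
    second = InE-suffix⇔ (d + i + 1) i (m ∸ i) vs (cong (_∸ i) len-vs) sorted-vs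

  cut→whole : ∀ i → i ≤ m → T ≡ d + suc m → Cut i → Whole
  cut→whole i i≤m T≡ c = let (b₁ , s) = to (cut⇔ i i≤m) c in
    from whole⇔ (b₁ , split-above d m (at vs) i i≤m s , T≡)
    where open Equivalence

  cut-unique : ∀ i j → i ≤ m → j ≤ m → Cut i → Cut j → i ≡ j
  cut-unique i j i≤m j≤m cᵢ cⱼ =
    split-unique d m (at vs) i j i≤m j≤m (proj₂ (to (cut⇔ i i≤m) cᵢ)) (proj₂ (to (cut⇔ j j≤m) cⱼ))
    where open Equivalence

  whole→T : Whole → T ≡ d + suc m
  whole→T = proj₂ ∘ proj₂ ∘ to whole⇔
    where open Equivalence

  whole→cut : Whole → ∃ λ i → i ≤ m × Cut i
  whole→cut w =
    let (b₁ , above , T≡) = to whole⇔ w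
        (i , i≤m , s) = split-exists d m (at vs) (bounded T≡) above
    in i , i≤m , from (cut⇔ i i≤m) (b₁ , s)
    where
    open Equivalence
    bounded : T ≡ d + suc m → ∀ p → p < m → at vs p ≤ d + suc m
    bounded T≡ p p<m = subst (at vs p ≤_) T≡
      (all-at vs (proj₂ (sorted-snoc⁻ vs sorted-vsT)) p (subst (p <_) (sym len-vs) p<m))

module Main (n : ℕ) where
  open Counting n

  Counts : List ℕ → List ℕ → Set
  Counts μ ts = (BlockCond 1 μ ts → paths n ts (sigma μ) ≡ 1) × (¬ BlockCond 1 μ ts → paths n ts (sigma μ) ≡ 0)

  module Step (pre : List ℕ) (m : ℕ) (ts : List ℕ) (T : ℕ)
              (sum≡ : sum (pre ∷ʳ suc m) ≡ length (ts ∷ʳ T)) (sorted : Sorted (ts ∷ʳ T))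
              (bounded : All (_≤ n) (ts ∷ʳ T)) (span≤n : span (pre ∷ʳ suc m) ≤ n) where

    σ : ℕ → ℕ
    σ = sigma (pre ∷ʳ suc m)
    d P : ℕ
    d = suc (span pre)
    P = d + suc m

    len : length ts ≡ sum pre + m
    len = ℕₚ.suc-injective (begin
      suc (length ts)     ≡⟨ sym (length-snoc ts T) ⟩
      length (ts ∷ʳ T)    ≡⟨ sym sum≡ ⟩
      sum (pre ∷ʳ suc m)  ≡⟨ sum-snoc pre (suc m) ⟩
      sum pre + suc m     ≡⟨ ℕₚ.+-suc (sum pre) m ⟩
      suc (sum pre + m)   ∎)
      where open ≡-Reasoning

    open LastBlock pre m ts T len sorted using (Whole; Cut; cut→whole; cut-unique; whole→T; whole→cut)

    sorted-ts : Sorted ts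
    sorted-ts = proj₁ (sorted-snoc⁻ ts sorted)

    ts≤T : All (_≤ T) ts
    ts≤T = proj₂ (sorted-snoc⁻ ts sorted)

    ts≤n : All (_≤ n) ts
    ts≤n = proj₁ (Allₚ.∷ʳ⁻ bounded)

    T≤n : T ≤ n
    T≤n = proj₂ (Allₚ.∷ʳ⁻ bounded)

    span≡P : span (pre ∷ʳ suc m) ≡ P
    span≡P = trans (span-++ pre (suc m ∷ [])) (block-sizes (span pre) m)
      where block-sizes : ∀ s m → s + suc (suc m + 0) ≡ suc s + suc m
            block-sizes = solve-∀

    P≤n : P ≤ n
    P≤n = subst (_≤ n) span≡P span≤n

    σP≡d : σ P ≡ d
    σP≡d = trans (sigma-++-above 1 pre (suc m ∷ []) P (ℕₚ.m≤m+n d (suc m))) (block-end d (suc m) [])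

    few-factors : length ts < E σ
    few-factors = begin-strict
      length ts         <⟨ ℕₚ.n<1+n _ ⟩
      suc (length ts)   ≡⟨ sym (length-snoc ts T) ⟩
      length (ts ∷ʳ T)  ≡⟨ sym sum≡ ⟩
      sum (pre ∷ʳ suc m) ≤⟨ excedances-sigma n (pre ∷ʳ suc m) span≤n ⟩
      E σ               ∎
      where open ℕₚ.≤-Reasoning

    -- A transposition (s T) with s < σ T, where T is not an excedance, leaves too many excedances.
    term-vanishes : ∀ j → σ T ≤ T → suc j < σ T → paths n ts (σ ∘ tr (suc j) T) ≡ 0
    term-vanishes j σT≤T 1+j<σT =
      paths-excedances ts (σ ∘ tr (suc j) T) ts≤n (ℕₚ.<-≤-trans few-factors (E-keep σ (suc j) T σT≤T 1+j<σT))

    -- T < P: the point P lies above every entry, but σ moves it.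
    T<end : T < P → Counts (pre ∷ʳ suc m) (ts ∷ʳ T)
    T<end T<P = (λ w → ⊥-elim (ℕₚ.<-irrefl (whole→T w) T<P)) ,
      (λ _ → paths-moved (ts ∷ʳ T) σ P (s≤s z≤n , P≤n)
               (Allₚ.∷ʳ⁺ (mapAll (λ t≤T → ℕₚ.≤-<-trans t≤T T<P) ts≤T) T<P) σP≢P)
      where
      σP≢P : σ P ≢ P
      σP≢P σP≡P = ℕₚ.<-irrefl (trans (sym σP≡d) σP≡P) (ℕₚ.m<m+n d (s≤s z≤n))

    -- T > P: σ fixes T, and every transposition (s T) leaves too many excedances.
    T>end : P < T → Counts (pre ∷ʳ suc m) (ts ∷ʳ T)
    T>end P<T = (λ w → ⊥-elim (ℕₚ.<-irrefl (sym (whole→T w)) P<T)) ,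
      (λ _ → trans (paths-snoc ts T σ T≤n) (Σ-zero (pred T) (λ j j<T-1 →
        term-vanishes j (ℕₚ.≤-reflexive σT≡T) (subst (suc j <_) (sym σT≡T) (below-pred j T j<T-1)))))
      where
      σT≡T : σ T ≡ T
      σT≡T = sigma-above 1 (pre ∷ʳ suc m) T (subst (_< T) (sym span≡P) P<T)

    cut-width : ∀ i → i ≤ m → i + suc (m ∸ i) ≡ suc m
    cut-width i i≤m = trans (ℕₚ.+-suc i (m ∸ i)) (cong suc (ℕₚ.m+[n∸m]≡n i≤m))

    cut-sum : ∀ i → i ≤ m → sum (pre ++ i ∷ (m ∸ i) ∷ []) ≡ length ts
    cut-sum i i≤m = begin
      sum (pre ++ i ∷ (m ∸ i) ∷ [])   ≡⟨ Sumₚ.sum-++ pre (i ∷ (m ∸ i) ∷ []) ⟩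
      sum pre + (i + (m ∸ i + 0))     ≡⟨ cong (λ z → sum pre + (i + z)) (ℕₚ.+-identityʳ (m ∸ i)) ⟩
      sum pre + (i + (m ∸ i))         ≡⟨ cong (_+_ (sum pre)) (ℕₚ.m+[n∸m]≡n i≤m) ⟩
      sum pre + m                     ≡⟨ sym len ⟩
      length ts                       ∎
      where open ≡-Reasoning

    cut-span : ∀ i → i ≤ m → span (pre ++ i ∷ (m ∸ i) ∷ []) ≤ n
    cut-span i i≤m = subst (_≤ n) (sym (begin
      span (pre ++ i ∷ (m ∸ i) ∷ [])      ≡⟨ span-++ pre (i ∷ (m ∸ i) ∷ []) ⟩
      span pre + suc (i + suc (m ∸ i + 0)) ≡⟨ cong (λ z → span pre + suc (i + suc z)) (ℕₚ.+-identityʳ (m ∸ i)) ⟩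
      span pre + suc (i + suc (m ∸ i))     ≡⟨ cong (λ z → span pre + suc z) (cut-width i i≤m) ⟩
      span pre + suc (suc m)               ≡⟨ cong (λ z → span pre + suc z) (sym (ℕₚ.+-identityʳ (suc m))) ⟩
      span pre + span (suc m ∷ [])         ≡⟨ sym (span-++ pre (suc m ∷ [])) ⟩
      span (pre ∷ʳ suc m)                  ∎)) span≤n
      where open ≡-Reasoning

    cut-term : T ≡ P → ∀ i → i ≤ m →
               paths n ts (σ ∘ tr (suc (span pre + i)) T) ≡ paths n ts (sigma (pre ++ i ∷ (m ∸ i) ∷ []))
    cut-term T≡P i i≤m = paths-cong ts (λ x → sym (trans (sigma-split 1 pre i (m ∸ i) x) (trans
      (cong (λ w → sigmaFrom 1 (pre ++ w ∷ []) (tr (d + i) (d + w) x)) (cut-width i i≤m))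
      (cong (λ z → σ (tr (d + i) z x)) (sym T≡P)))))

    -- T = P: the transpositions (s P) with s < d leave too many excedances; those with
    -- s = d + i contribute the indicator of the cut condition at i, which holds for exactly
    -- one i precisely when the condition for μ holds.
    T≡end : T ≡ P → (∀ i → i ≤ m → Counts (pre ++ i ∷ (m ∸ i) ∷ []) ts) →
            Counts (pre ∷ʳ suc m) (ts ∷ʳ T)
    T≡end T≡P counts-cut =
      (λ w → trans peeled (cuts-sum-to-one w)) , (λ ¬w → trans peeled (cuts-sum-to-zero ¬w))
      where
      f : ℕ → ℕ
      f j = paths n ts (σ ∘ tr (suc j) T)
      g : ℕ → ℕ
      g i = f (span pre + i)
      σT≡d : σ T ≡ d
      σT≡d = trans (cong σ T≡P) σP≡d
      before-block : ∀ j → j < span pre → f j ≡ 0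
      before-block j j<span = term-vanishes j
        (subst (_≤ T) (sym σT≡d) (ℕₚ.≤-trans (ℕₚ.m≤m+n d (suc m)) (ℕₚ.≤-reflexive (sym T≡P))))
        (subst (suc j <_) (sym σT≡d) (s≤s j<span))
      peeled : paths n (ts ∷ʳ T) σ ≡ Σ (suc m) g
      peeled = begin
        paths n (ts ∷ʳ T) σ           ≡⟨ paths-snoc ts T σ T≤n ⟩
        Σ (pred T) f                  ≡⟨ cong (λ z → Σ (pred z) f) T≡P ⟩
        Σ (span pre + suc m) f        ≡⟨ Σ-split (span pre) (suc m) f ⟩
        Σ (span pre) f + Σ (suc m) g  ≡⟨ cong (_+ Σ (suc m) g) (Σ-zero (span pre) before-block) ⟩
        Σ (suc m) g                   ∎
        where open ≡-Reasoning
      indicator : ∀ i → i < suc m → (Cut i → g i ≡ 1) × (¬ Cut i → g i ≡ 0)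
      indicator i (s≤s i≤m) = let (holds , fails) = counts-cut i i≤m in
        (λ c → trans (cut-term T≡P i i≤m) (holds c)) , (λ ¬c → trans (cut-term T≡P i i≤m) (fails ¬c))
      cuts-sum-to-one : Whole → Σ (suc m) g ≡ 1
      cuts-sum-to-one w = let (i₀ , i₀≤m , cᵢ₀) = whole→cut w in
        Σ-exactly-one (suc m) g Cut indicator
          (λ i j i<1+m j<1+m → cut-unique i j (ℕₚ.≤-pred i<1+m) (ℕₚ.≤-pred j<1+m)) i₀ (s≤s i₀≤m) cᵢ₀
      cuts-sum-to-zero : ¬ Whole → Σ (suc m) g ≡ 0
      cuts-sum-to-zero ¬w = Σ-zero (suc m) (λ i i<1+m →
        proj₂ (indicator i i<1+m) (¬w ∘ cut→whole i (ℕₚ.≤-pred i<1+m) T≡P))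

    last-block : (∀ i → i ≤ m → Counts (pre ++ i ∷ (m ∸ i) ∷ []) ts) → Counts (pre ∷ʳ suc m) (ts ∷ʳ T)
    last-block counts-cut with ℕₚ.<-cmp T P
    ... | tri< T<P _ _ = T<end T<P
    ... | tri≈ _ T≡P _ = T≡end T≡P counts-cut
    ... | tri> _ _ P<T = T>end P<T

  counts-drop-empty : ∀ pre ts → length ts ≡ sum pre → Counts pre ts → Counts (pre ∷ʳ 0) ts
  counts-drop-empty pre ts len (holds , fails) =
    (λ b → trans same-σ (holds (to cond b))) , (λ ¬b → trans same-σ (fails (¬b ∘ from cond)))
    where
    open Equivalence
    cond : BlockCond 1 (pre ∷ʳ 0) ts ⇔ BlockCond 1 pre ts
    cond = blockCond-drop-empty 1 pre ts len
    same-σ : paths n ts (sigma (pre ∷ʳ 0)) ≡ paths n ts (sigma pre)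
    same-σ = paths-cong ts (sigma-drop-empty 1 pre)

  counts : ∀ {μ ts} → Reverse ts → Reverse μ →
           sum μ ≡ length ts → Sorted ts → All (_≤ n) ts → span μ ≤ n → Counts μ ts
  counts []             []                  _    _      _       _      =
    (λ _ → paths-[]-id (sigma []) (λ _ _ → refl)) , (λ ¬b → ⊥-elim (¬b tt))
  counts (ts ∶ _ ∶ʳ T)  []                  sum≡ _      _       _      =
    ⊥-elim (ℕₚ.1+n≢0 (trans (sym (length-snoc ts T)) (sym sum≡)))
  counts rts            (pre ∶ rpre ∶ʳ zero) sum≡ sorted bounded span≤n =
    counts-drop-empty pre _ len (counts rts rpre (sym len) sorted bounded
      (ℕₚ.≤-trans (ℕₚ.m≤m+n (span pre) 1) (subst (_≤ n) (span-++ pre (0 ∷ [])) span≤n)))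
    where len = trans (sym sum≡) (trans (sum-snoc pre 0) (ℕₚ.+-identityʳ _))
  counts []             (pre ∶ _ ∶ʳ suc m)   sum≡ _      _       _      =
    ⊥-elim (ℕₚ.1+n≢0 (trans (sym (ℕₚ.+-suc (sum pre) m)) (trans (sym (sum-snoc pre (suc m))) sum≡)))
  counts (ts ∶ rts ∶ʳ T) (pre ∶ _ ∶ʳ suc m)  sum≡ sorted bounded span≤n =
    last-block (λ i i≤m → counts rts (reverseView _) (cut-sum i i≤m) sorted-ts ts≤n (cut-span i i≤m))
    where open Step pre m ts T sum≡ sorted bounded span≤n

proposition5p20 : (k : ℕ) (μ : List ℕ) (ts : List ℕ) (n : ℕ)
    → IsPartition k μ
    → length ts ≡ k
    → All (2 ≤_) ts
    → Linked _≤_ ts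
    → All (_≤ n) ts
    → k + length μ ≤ n
    → (BlockCond 1 μ ts → coeff (sigma μ) (JProd n ts) ≡ + 1)
      × (¬ BlockCond 1 μ ts → coeff (sigma μ) (JProd n ts) ≡ + 0)
proposition5p20 k μ ts n (_ , _ , sum≡k) len _ sorted bounded k+ℓ≤n =
  (λ b → trans coefficient (cong +_ (holds b))) , (λ ¬b → trans coefficient (cong +_ (fails ¬b)))
  where
  coefficient : coeff (sigma μ) (JProd n ts) ≡ + paths n ts (sigma μ)
  coefficient = coeff-JProd n ts (sigma μ) bounded
  span≤n : span μ ≤ n
  span≤n = subst (_≤ n) (sym (trans (span-sum μ) (cong (_+ length μ) sum≡k))) k+ℓ≤n
  open Main n using (Counts; counts)
  counted : Counts μ ts
  counted = counts (reverseView ts) (reverseView μ) (trans sum≡k (sym len)) sorted bounded span≤n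
  holds : BlockCond 1 μ ts → paths n ts (sigma μ) ≡ 1
  holds = proj₁ counted
  fails : ¬ BlockCond 1 μ ts → paths n ts (sigma μ) ≡ 0
  fails = proj₂ counted
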